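{- Let $\mathcal{D}=(\mathcal{P},\mathcal{B})$ be a Steiner $3$-design with $v$ points and block size $k$, and let $G\leq\mathrm{Aut}(\mathcal{D})$ act transitively on $\mathcal{B}$. Then: (i) $(v-1)(v-2)$ divides $k(k-1)(k-2)|G_\alpha|$ for every $\alpha\in\mathcal{P}$; (ii) $(v-1)(v-2)$ divides $k(k-1)(k-2)d(d-1)$ for every nontrivial subdegree $d$ of $G$.
   Context: A Steiner $3$-design $\mathcal{D}=(\mathcal{P},\mathcal{B})$ consists of a finite set $\mathcal{P}$ of $v$ points and a set $\mathcal{B}$ of $k$-element subsets of $\mathcal{P}$ (blocks) such that any $3$ distinct points lie in exactly one block. $\mathrm{Aut}(\mathcal{D})$ is the group of permutations of $\mathcal{P}$ mapping blocks to blocks. A block-transitive group is also transitive on points. $G_\alpha$ is the stabilizer of the point $\alpha$. A subdegree of the (point-transitive) group $G$ is the length of an orbit of a point stabilizer $G_\alpha$ on $\mathcal{P}$; it is nontrivial if the orbit is not $\{\alpha\}$. -}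

module Defs where

open import Data.Nat using (ℕ)
open import Data.Fin using (Fin)
open import Data.Fin.Properties using (_≟_)
open import Data.Fin.Subset using (Subset; _∈_; ∣_∣)
open import Data.Vec using (tabulate)
open import Data.List using (List; filter; length)
open import Data.List.Membership.Propositional using () renaming (_∈_ to _∈ₗ_)
open import Data.List.Relation.Unary.Any using (Any; any?)
open import Data.List.Relation.Unary.AllPairs using (AllPairs)
open import Data.List.Relation.Unary.Unique.Propositional using (Unique)
open import Data.Product using (Σ; _×_; ∃)
open import Function using (_∘_; id)
open import Function.Bundles using (_⇔_)
open import Function.Definitions using (Injective)
open import Relation.Nullary using (¬_)
open import Relation.Nullary.Decidable using (⌊_⌋)
open import Relation.Binary.PropositionalEquality using (_≡_; _≢_; _≗_)

record Steiner3Design (v k : ℕ) : Set where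
  field
    blocks        : List (Subset v)
    blocksUnique  : Unique blocks
    -- the design has at least one block (excludes the empty degenerate case)
    blocksNonEmpty : Σ (Subset v) λ B → B ∈ₗ blocks
    blockSize     : ∀ {B} → B ∈ₗ blocks → ∣ B ∣ ≡ k
    steinerExists : ∀ x y z → x ≢ y → y ≢ z → x ≢ z →
                    Σ (Subset v) λ B → B ∈ₗ blocks × x ∈ B × y ∈ B × z ∈ B
    steinerUnique : ∀ x y z → x ≢ y → y ≢ z → x ≢ z → ∀ B B' →
                    B ∈ₗ blocks → x ∈ B → y ∈ B → z ∈ B →
                    B' ∈ₗ blocks → x ∈ B' → y ∈ B' → z ∈ B' → B ≡ B'

open Steiner3Design public

-- g maps the subset B onto B' (for bijective g: g(B) = B').
MapsTo : ∀ {v} → (Fin v → Fin v) → Subset v → Subset v → Set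
MapsTo g B B' = ∀ x → (x ∈ B ⇔ g x ∈ B')

IsAut : ∀ {v k} → Steiner3Design v k → (Fin v → Fin v) → Set
IsAut D g = Injective _≡_ _≡_ g ×
            (∀ {B} → B ∈ₗ blocks D → Σ _ λ B' → B' ∈ₗ blocks D × MapsTo g B B')

-- A subgroup G ≤ Aut(D), given by the (finite) list of its elements,
-- pairwise distinct as permutations, containing the identity and closed
-- under composition (hence a subgroup, as everything is finite).
record AutSubgroup {v k : ℕ} (D : Steiner3Design v k) : Set where
  field
    elems    : List (Fin v → Fin v)
    distinct : AllPairs (λ g h → ¬ (g ≗ h)) elems
    auts     : ∀ {g} → g ∈ₗ elems → IsAut D g
    hasId    : Any (λ h → h ≗ id) elems
    closed   : ∀ {g h} → g ∈ₗ elems → h ∈ₗ elems → Any (λ f → f ≗ g ∘ h) elems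

open AutSubgroup public

BlockTransitive : ∀ {v k} {D : Steiner3Design v k} → AutSubgroup D → Set
BlockTransitive {D = D} G = ∀ {B B'} → B ∈ₗ blocks D → B' ∈ₗ blocks D →
                            Any (λ g → MapsTo g B B') (elems G)

stabilizer : ∀ {v k} {D : Steiner3Design v k} → AutSubgroup D → Fin v → List (Fin v → Fin v)
stabilizer G α = filter (λ g → g α ≟ α) (elems G)

stabOrder : ∀ {v k} {D : Steiner3Design v k} → AutSubgroup D → Fin v → ℕ
stabOrder G α = length (stabilizer G α)

orbitOfStab : ∀ {v k} {D : Steiner3Design v k} → AutSubgroup D → Fin v → Fin v → Subset v
orbitOfStab G α β = tabulate (λ γ → ⌊ any? (λ g → g β ≟ γ) (stabilizer G α) ⌋)

subdegree : ∀ {v k} {D : Steiner3Design v k} → AutSubgroup D → Fin v → Fin v → ℕ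
subdegree G α β = ∣ orbitOfStab G α β ∣

-- Double counting of ordered triples of distinct points. Three distinct points lie in
-- exactly one block and G permutes the blocks transitively, so every G-invariant set T
-- of such triples has |T| = b |T ∩ B³| for a fixed block B; for T = all triples this is
-- v(v-1)(v-2) = b k(k-1)(k-2). For a point orbit O, the sets O×P×P and O×O×P force
-- O = P unless k = v, so G is point-transitive. Then the G-orbit of a triple (α, y, z)
-- gives v |G_α| = |G| = b n |G_(α,y,z)|, and the triples (x, y, z) that some element
-- maps into {α} × Δ × Δ, for the G_α-orbit Δ of β, give v d(d-1) = b n. Each is of the
-- form v X = b Y; multiplying by k(k-1)(k-2) and cancelling v yields
-- (v-1)(v-2) ∣ k(k-1)(k-2) X.
module Submission where

open import Defs
open import Data.Nat using (ℕ; zero; suc; _+_; _*_; _∸_; _≤_; z≤n; s≤s; NonZero)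
open import Data.Nat.Properties hiding (_≟_)
open import Data.Nat.Divisibility using (_∣_; divides; _∣0)
open import Data.Bool using (Bool; true; false; _∧_; not)
open import Data.Bool.Properties using (∧-assoc) renaming (_≟_ to _≟ᵇ_)
open import Data.Fin using (Fin; zero; suc; punchOut)
open import Data.Fin.Properties using (_≟_; any?; injective⇒≤; punchOut-injective)
open import Data.Fin.Permutation using (Permutation; permutation)
open import Data.Fin.Subset using (Subset; ∣_∣; _∈_)
open import Data.Fin.Subset.Properties using (∣p∣≤n; ∣p∣≡n⇒p≡⊤)
import Data.Vec as Vec
import Data.Vec.Properties as Vec
open import Data.List using (List; []; _∷_; length; lookup; filter)
open import Data.List.Relation.Unary.All as All using ()
open import Data.List.Relation.Unary.Any as Any using (Any; here; there)
import Data.List.Relation.Unary.Any as List using (any?)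
open import Data.List.Relation.Unary.Any.Properties using (lookup-index)
open import Data.List.Relation.Unary.AllPairs using (AllPairs; []; _∷_)
open import Data.List.Membership.Propositional.Properties using (∈-lookup)
open import Data.Product using (∃; _×_; _,_; proj₁; proj₂)
open import Data.Sum as Sum using (_⊎_; inj₁; inj₂; [_,_]′)
open import Function using (_∘_; id)
open import Function.Definitions using (Injective)
open import Relation.Nullary using (¬_; does; yes; no; Dec; contradiction; _×-dec_)
open import Relation.Binary.Definitions using (DecidableEquality)
open import Relation.Nullary.Decidable using (⌊_⌋; dec-true; dec-false; does-⇔; map′; isYes≗does)
open import Function.Bundles using (mk⇔; Equivalence; _⇔_)
open import Relation.Binary.PropositionalEquality
open import Algebra.Properties.Semiring.Sum +-*-semiring
  using (sum; sum-syntax; sum-cong-≗; ∑-comm; ∑-distrib-+; *-distribˡ-sum; sum-permute)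
open import Data.Nat.Solver using (module +-*-Solver)
open import Data.Bool.Solver using (module ∨-∧-Solver)
open ≡-Reasoning

-- Finite sums

∑-const : ∀ n c → ∑[ i < n ] c ≡ n * c
∑-const zero    c = refl
∑-const (suc n) c = cong (c +_) (∑-const n c)

∑-*ˡ : ∀ {n} c (f : Fin n → ℕ) → ∑[ i < n ] (c * f i) ≡ c * ∑[ i < n ] f i
∑-*ˡ c f = sym (*-distribˡ-sum c f)

∑-*ʳ : ∀ {n} c (f : Fin n → ℕ) → ∑[ i < n ] (f i * c) ≡ (∑[ i < n ] f i) * c
∑-*ʳ {n} c f = begin
  ∑[ i < n ] (f i * c)   ≡⟨ sum-cong-≗ (λ i → *-comm (f i) c) ⟩
  ∑[ i < n ] (c * f i)   ≡⟨ ∑-*ˡ c f ⟩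
  c * ∑[ i < n ] f i     ≡⟨ *-comm c _ ⟩
  (∑[ i < n ] f i) * c   ∎

term≤∑ : ∀ {n} (f : Fin n → ℕ) i → f i ≤ ∑[ j < n ] f j
term≤∑ f zero    = m≤m+n _ _
term≤∑ f (suc i) = ≤-trans (term≤∑ (f ∘ suc) i) (m≤n+m _ (f zero))

-- An injective endomap of a finite set misses no point: a missed point would
-- let it be punched out, giving an injection Fin (suc m) → Fin m.
injective⇒surjective : ∀ {n} {σ : Fin n → Fin n} → Injective _≡_ _≡_ σ →
                       ∀ y → ∃ λ x → σ x ≡ y
injective⇒surjective {suc m} {σ} inj y with any? (λ x → σ x ≟ y)
... | yes hit = hit
... | no miss = contradiction (injective⇒≤ squeezed-injective) (<-irrefl refl)
  where
  squeezed : Fin (suc m) → Fin m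
  squeezed x = punchOut {i = y} (λ y≡σx → miss (x , sym y≡σx))
  squeezed-injective : Injective _≡_ _≡_ squeezed
  squeezed-injective = inj ∘ punchOut-injective {i = y} _ _

∑-reindex : ∀ {n} {σ : Fin n → Fin n} → Injective _≡_ _≡_ σ →
            (f : Fin n → ℕ) → ∑[ i < n ] f (σ i) ≡ ∑[ i < n ] f i
∑-reindex {n} {σ} inj f = sym (sum-permute f π)
  where
  σ⁻¹ : Fin n → Fin n
  σ⁻¹ y = proj₁ (injective⇒surjective inj y)
  π : Permutation n n
  π = permutation σ σ⁻¹ (λ y → proj₂ (injective⇒surjective inj y))
                        (λ x → inj (proj₂ (injective⇒surjective inj (σ x))))

-- Counting Boolean predicates

χ : Bool → ℕ
χ true  = 1
χ false = 0

χ-∧ : ∀ a b → χ (a ∧ b) ≡ χ a * χ b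
χ-∧ true  b = sym (*-identityˡ (χ b))
χ-∧ false b = refl

χ-split : ∀ a b → χ a ≡ χ (a ∧ not b) + χ (a ∧ b)
χ-split true  true  = refl
χ-split true  false = refl
χ-split false b     = refl

χ*-cong : ∀ b {m n} → (b ≡ true → m ≡ n) → χ b * m ≡ χ b * n
χ*-cong true  m≡n = cong (_+ 0) (m≡n refl)
χ*-cong false m≡n = refl

∧-absorbˡ : ∀ {a b} → (b ≡ true → a ≡ true) → a ∧ b ≡ b
∧-absorbˡ {true}  {b}     b⇒a = refl
∧-absorbˡ {false} {true}  b⇒a = b⇒a refl
∧-absorbˡ {false} {false} b⇒a = refl

∧-true : ∀ {a b} → a ∧ b ≡ true → a ≡ true × b ≡ true
∧-true {true} b≡true = refl , b≡true

≡true-ext : ∀ {a b : Bool} → (a ≡ true → b ≡ true) → (b ≡ true → a ≡ true) → a ≡ b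
≡true-ext {true}  {true}  _ _ = refl
≡true-ext {true}  {false} a⇒b _ = sym (a⇒b refl)
≡true-ext {false} {true}  _ b⇒a = b⇒a refl
≡true-ext {false} {false} _ _ = refl

-- Defined with does rather than ⌊_⌋ so that suc i == suc j reduces to i == j.
_==_ : ∀ {n} → Fin n → Fin n → Bool
i == j = does (i ≟ j)

==-refl : ∀ {n} (i : Fin n) → (i == i) ≡ true
==-refl i = dec-true (i ≟ i) refl

does⇒ : ∀ {A : Set} (d : Dec A) → does d ≡ true → A
does⇒ (yes a) _ = a

not==⇒≢ : ∀ {n} {i j : Fin n} → not (i == j) ≡ true → i ≢ j
not==⇒≢ {i = i} i≠j refl = contradiction (trans (cong not (sym (==-refl i))) i≠j) λ ()

==-sym : ∀ {n} (i j : Fin n) → (i == j) ≡ (j == i)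
==-sym i j = does-⇔ (mk⇔ sym sym) (i ≟ j) (j ≟ i)

==-injective : ∀ {n} {σ : Fin n → Fin n} → Injective _≡_ _≡_ σ → ∀ i j → (σ i == σ j) ≡ (i == j)
==-injective {σ = σ} inj i j = does-⇔ (mk⇔ inj (cong σ)) (σ i ≟ σ j) (i ≟ j)

∑-δ : ∀ {n} (a : Fin n) (f : Fin n → ℕ) → ∑[ i < n ] (χ (a == i) * f i) ≡ f a
∑-δ {suc n} zero    f = begin
  f zero + 0 + ∑[ i < n ] 0   ≡⟨ cong (f zero + 0 +_) (trans (∑-const n 0) (*-zeroʳ n)) ⟩
  f zero + 0 + 0             ≡⟨ trans (+-identityʳ _) (+-identityʳ _) ⟩
  f zero                     ∎
∑-δ {suc n} (suc a) f = ∑-δ a (f ∘ suc)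

∑-==-point : ∀ {n} (a : Fin n) → ∑[ x < n ] χ (x == a) ≡ 1
∑-==-point {n} a = begin
  ∑[ x < n ] χ (x == a)             ≡⟨ sum-cong-≗ (λ x → trans (cong χ (==-sym x a)) (sym (*-identityʳ _))) ⟩
  ∑[ x < n ] (χ (a == x) * 1)       ≡⟨ ∑-δ a (λ _ → 1) ⟩
  1                                 ∎

count : ∀ {n} → (Fin n → Bool) → ℕ
count {n} P = ∑[ i < n ] χ (P i)

_⊆_ : ∀ {n} → (Fin n → Bool) → (Fin n → Bool) → Set
P ⊆ Q = ∀ i → P i ≡ true → Q i ≡ true

except : ∀ {n} → Fin n → (Fin n → Bool) → Fin n → Bool
except a P i = P i ∧ not (a == i)

∣p∣≡count : ∀ {n} (p : Subset n) → ∣ p ∣ ≡ count (Vec.lookup p)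
∣p∣≡count Vec.[]             = refl
∣p∣≡count (true  Vec.∷ p) = cong suc (∣p∣≡count p)
∣p∣≡count (false Vec.∷ p) = ∣p∣≡count p

count-tabulate : ∀ {n} (P : Fin n → Bool) → ∣ Vec.tabulate P ∣ ≡ count P
count-tabulate P = trans (∣p∣≡count (Vec.tabulate P)) (sum-cong-≗ (cong χ ∘ Vec.lookup∘tabulate P))

count≡n⇒all : ∀ {n} (P : Fin n → Bool) → count P ≡ n → ∀ i → P i ≡ true
count≡n⇒all {n} P count≡n i = begin
  P i                                  ≡⟨ Vec.lookup∘tabulate P i ⟨
  Vec.lookup (Vec.tabulate P) i        ≡⟨ cong (λ p → Vec.lookup p i) (∣p∣≡n⇒p≡⊤ {p = Vec.tabulate P} (trans (count-tabulate P) count≡n)) ⟩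
  Vec.lookup (Vec.replicate n true) i  ≡⟨ Vec.lookup-replicate i true ⟩
  true                                 ∎

count-zero : ∀ {n} (P : Fin n → Bool) → (∀ i → P i ≡ false) → count P ≡ 0
count-zero {n} P none = trans (sum-cong-≗ (cong χ ∘ none)) (trans (∑-const n 0) (*-zeroʳ n))

count-split : ∀ {n} (P : Fin n → Bool) a → count P ≡ count (except a P) + χ (P a)
count-split {n} P a = begin
  count P                                                         ≡⟨ sum-cong-≗ (λ i → χ-split (P i) (a == i)) ⟩
  ∑[ i < n ] (χ (except a P i) + χ (P i ∧ (a == i)))              ≡⟨ ∑-distrib-+ (χ ∘ except a P) (λ i → χ (P i ∧ (a == i))) ⟩
  count (except a P) + ∑[ i < n ] χ (P i ∧ (a == i))              ≡⟨ cong (count (except a P) +_) δ-term ⟩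
  count (except a P) + χ (P a)                                    ∎
  where
  δ-term : ∑[ i < n ] χ (P i ∧ (a == i)) ≡ χ (P a)
  δ-term = trans (sum-cong-≗ (λ i → trans (χ-∧ (P i) (a == i)) (*-comm (χ (P i)) _))) (∑-δ a (χ ∘ P))

count-except : ∀ {n} (P : Fin n → Bool) {a} → P a ≡ true → count (except a P) ≡ count P ∸ 1
count-except P {a} Pa = sym (begin
  count P ∸ 1                          ≡⟨ cong (_∸ 1) (count-split P a) ⟩
  (count (except a P) + χ (P a)) ∸ 1   ≡⟨ cong (λ b → (count (except a P) + χ b) ∸ 1) Pa ⟩
  (count (except a P) + 1) ∸ 1         ≡⟨ m+n∸n≡m _ 1 ⟩
  count (except a P)                   ∎)

count-unique : ∀ {n} (P : Fin n → Bool) {a} → P a ≡ true →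
               (∀ i → P i ≡ true → i ≡ a) → count P ≡ 1
count-unique P {a} Pa unique = begin
  count P                         ≡⟨ count-split P a ⟩
  count (except a P) + χ (P a)    ≡⟨ cong₂ _+_ (count-zero (except a P) only-a) (cong χ Pa) ⟩
  1                               ∎
  where
  only-a : ∀ i → except a P i ≡ false
  only-a i with P i in Pi
  ... | false = refl
  ... | true  = cong not (dec-true (a ≟ i) (sym (unique i Pi)))

∑-χ*-const : ∀ {n} (P : Fin n → Bool) {f : Fin n → ℕ} {c} → (∀ i → P i ≡ true → f i ≡ c) →
             ∑[ i < n ] (χ (P i) * f i) ≡ count P * c
∑-χ*-const P {f} {c} f≡c = trans (sum-cong-≗ (λ i → χ*-cong (P i) (f≡c i))) (∑-*ʳ c (χ ∘ P))

count-pairs : ∀ {n} (P : Fin n → Bool) →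
              ∑[ y < n ] ∑[ z < n ] χ (P y ∧ except y P z) ≡ count P * (count P ∸ 1)
count-pairs {n} P = begin
  ∑[ y < n ] ∑[ z < n ] χ (P y ∧ except y P z)      ≡⟨ sum-cong-≗ (λ y → sum-cong-≗ (χ-∧ (P y) ∘ except y P)) ⟩
  ∑[ y < n ] ∑[ z < n ] (χ (P y) * χ (except y P z)) ≡⟨ sum-cong-≗ (λ y → ∑-*ˡ (χ (P y)) (χ ∘ except y P)) ⟩
  ∑[ y < n ] (χ (P y) * count (except y P))         ≡⟨ ∑-χ*-const P (λ y → count-except P) ⟩
  count P * (count P ∸ 1)                           ∎

-- Triples of points

Triple : ℕ → Set
Triple n = Fin n × Fin n × Fin n

TripleSet : ℕ → Set
TripleSet n = Fin n → Fin n → Fin n → Bool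

distinct₃ : ∀ {n} → TripleSet n
distinct₃ x y z = not (x == y) ∧ not (y == z) ∧ not (x == z)

∑₃ : ∀ {n} → (Fin n → Fin n → Fin n → ℕ) → ℕ
∑₃ {n} f = ∑[ x < n ] ∑[ y < n ] ∑[ z < n ] f x y z

∑₃-cong : ∀ {n} {f g : Fin n → Fin n → Fin n → ℕ} → (∀ x y z → f x y z ≡ g x y z) → ∑₃ f ≡ ∑₃ g
∑₃-cong f≡g = sum-cong-≗ (λ x → sum-cong-≗ (λ y → sum-cong-≗ (f≡g x y)))

#₃ : ∀ {n} → TripleSet n → ℕ
#₃ T = ∑₃ λ x y z → χ (distinct₃ x y z ∧ T x y z)

∑₃-reindex : ∀ {n} {σ : Fin n → Fin n} → Injective _≡_ _≡_ σ → (f : Fin n → Fin n → Fin n → ℕ) →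
             ∑₃ (λ x y z → f (σ x) (σ y) (σ z)) ≡ ∑₃ f
∑₃-reindex {n} {σ} inj f = begin
  ∑₃ (λ x y z → f (σ x) (σ y) (σ z))      ≡⟨ sum-cong-≗ (λ x → sum-cong-≗ (λ y → ∑-reindex inj (f (σ x) (σ y)))) ⟩
  ∑₃ (λ x y z → f (σ x) (σ y) z)          ≡⟨ sum-cong-≗ (λ x → ∑-reindex inj (λ y → ∑[ z < n ] f (σ x) y z)) ⟩
  ∑₃ (λ x y z → f (σ x) y z)              ≡⟨ ∑-reindex inj (λ x → ∑[ y < n ] ∑[ z < n ] f x y z) ⟩
  ∑₃ f                                    ∎

distinct₃-injective : ∀ {n} {σ : Fin n → Fin n} → Injective _≡_ _≡_ σ →
                      ∀ x y z → distinct₃ (σ x) (σ y) (σ z) ≡ distinct₃ x y z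
distinct₃-injective inj x y z
  rewrite ==-injective inj x y | ==-injective inj y z | ==-injective inj x z = refl

∑-∑₃-comm : ∀ {m n} (f : Fin m → Fin n → Fin n → Fin n → ℕ) →
            ∑[ i < m ] ∑₃ (f i) ≡ ∑₃ (λ x y z → ∑[ i < m ] f i x y z)
∑-∑₃-comm {m} {n} f = begin
  ∑[ i < m ] ∑₃ (f i)                                               ≡⟨ ∑-comm (λ i x → ∑[ y < n ] ∑[ z < n ] f i x y z) ⟩
  ∑[ x < n ] ∑[ i < m ] ∑[ y < n ] ∑[ z < n ] f i x y z             ≡⟨ sum-cong-≗ (λ x → ∑-comm (λ i y → ∑[ z < n ] f i x y z)) ⟩
  ∑[ x < n ] ∑[ y < n ] ∑[ i < m ] ∑[ z < n ] f i x y z             ≡⟨ sum-cong-≗ (λ x → sum-cong-≗ (λ y → ∑-comm (λ i z → f i x y z))) ⟩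
  ∑₃ (λ x y z → ∑[ i < m ] f i x y z)                               ∎

_≟₃_ : ∀ {n} → DecidableEquality (Triple n)
(x , y , z) ≟₃ (x′ , y′ , z′) =
  map′ (λ (p , q , r) → cong₂ _,_ p (cong₂ _,_ q r)) (λ { refl → refl , refl , refl })
       (x ≟ x′ ×-dec y ≟ y′ ×-dec z ≟ z′)

∑₃-product : ∀ {n} (f g h : Fin n → ℕ) → ∑₃ (λ x y z → f x * (g y * h z)) ≡ sum f * (sum g * sum h)
∑₃-product {n} f g h = begin
  ∑₃ (λ x y z → f x * (g y * h z))
    ≡⟨ sum-cong-≗ (λ x → sum-cong-≗ (λ y → trans (∑-*ˡ (f x) (λ z → g y * h z)) (cong (f x *_) (∑-*ˡ (g y) h)))) ⟩
  ∑[ x < n ] ∑[ y < n ] (f x * (g y * sum h))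
    ≡⟨ sum-cong-≗ (λ x → trans (∑-*ˡ (f x) (λ y → g y * sum h)) (cong (f x *_) (∑-*ʳ (sum h) g))) ⟩
  ∑[ x < n ] (f x * (sum g * sum h))
    ≡⟨ ∑-*ʳ (sum g * sum h) f ⟩
  sum f * (sum g * sum h) ∎

∑₃-point : ∀ {n} (t : Triple n) → ∑₃ (λ x y z → χ (does ((x , y , z) ≟₃ t))) ≡ 1
∑₃-point (a , b , c) = begin
  ∑₃ (λ x y z → χ ((x == a) ∧ (y == b) ∧ (z == c)))
    ≡⟨ ∑₃-cong (λ x y z → trans (χ-∧ (x == a) _) (cong (χ (x == a) *_) (χ-∧ (y == b) (z == c)))) ⟩
  ∑₃ (λ x y z → χ (x == a) * (χ (y == b) * χ (z == c)))
    ≡⟨ ∑₃-product (λ x → χ (x == a)) (λ y → χ (y == b)) (λ z → χ (z == c)) ⟩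
  sum (λ x → χ (x == a)) * (sum (λ y → χ (y == b)) * sum (λ z → χ (z == c)))
    ≡⟨ cong₂ _*_ (∑-==-point a) (cong₂ _*_ (∑-==-point b) (∑-==-point c)) ⟩
  1 ∎

∑₃-*ʳ : ∀ {n} c (f : Fin n → Fin n → Fin n → ℕ) → ∑₃ (λ x y z → f x y z * c) ≡ ∑₃ f * c
∑₃-*ʳ {n} c f = begin
  ∑₃ (λ x y z → f x y z * c)                   ≡⟨ sum-cong-≗ (λ x → sum-cong-≗ (λ y → ∑-*ʳ c (f x y))) ⟩
  ∑[ x < n ] ∑[ y < n ] (∑[ z < n ] f x y z * c) ≡⟨ sum-cong-≗ (λ x → ∑-*ʳ c (λ y → ∑[ z < n ] f x y z)) ⟩
  ∑[ x < n ] (∑[ y < n ] ∑[ z < n ] f x y z * c) ≡⟨ ∑-*ʳ c (λ x → ∑[ y < n ] ∑[ z < n ] f x y z) ⟩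
  ∑₃ f * c                                     ∎

distinct-partners : ∀ {V} (α : Fin (3 + V)) → ∃ λ y → ∃ λ z → distinct₃ α y z ≡ true
distinct-partners zero             = suc zero , suc (suc zero) , refl
distinct-partners (suc zero)       = zero , suc (suc zero) , refl
distinct-partners (suc (suc _))    = zero , suc zero , refl

box : ∀ {n} → (Fin n → Bool) → (Fin n → Bool) → (Fin n → Bool) → TripleSet n
box X Y Z x y z = X x ∧ Y y ∧ Z z

#₃-box : ∀ {n} (X Y Z : Fin n → Bool) → X ⊆ Y → Y ⊆ Z →
         #₃ (box X Y Z) ≡ count X * (count Y ∸ 1) * (count Z ∸ 2)
#₃-box {n} X Y Z X⊆Y Y⊆Z = begin
  #₃ (box X Y Z)
    ≡⟨ ∑₃-cong (λ x y z → trans (cong χ (regroup x y z)) (χ-∧ (X x) _)) ⟩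
  ∑[ x < n ] ∑[ y < n ] ∑[ z < n ] (χ (X x) * rest x y z)
    ≡⟨ sum-cong-≗ (λ x → trans (sum-cong-≗ (λ y → ∑-*ˡ (χ (X x)) (rest x y))) (∑-*ˡ (χ (X x)) (λ y → ∑[ z < n ] rest x y z))) ⟩
  ∑[ x < n ] (χ (X x) * ∑[ y < n ] ∑[ z < n ] rest x y z)
    ≡⟨ ∑-χ*-const X rest-count ⟩
  count X * ((count Y ∸ 1) * (count Z ∸ 2))
    ≡⟨ *-assoc (count X) _ _ ⟨
  count X * (count Y ∸ 1) * (count Z ∸ 2) ∎
  where
  rest : Fin n → Fin n → Fin n → ℕ
  rest x y z = χ (except x Y y ∧ except y (except x Z) z)
  regroup : ∀ x y z → distinct₃ x y z ∧ box X Y Z x y z ≡ X x ∧ (except x Y y ∧ except y (except x Z) z)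
  regroup x y z = solve 6 (λ a b c p q r → (a :* (b :* c)) :* (p :* (q :* r)) := p :* ((q :* a) :* ((r :* c) :* b)))
                    refl (not (x == y)) (not (y == z)) (not (x == z)) (X x) (Y y) (Z z)
    where open ∨-∧-Solver
  rest-count : ∀ x → X x ≡ true → ∑[ y < n ] ∑[ z < n ] rest x y z ≡ (count Y ∸ 1) * (count Z ∸ 2)
  rest-count x Xx = begin
    ∑[ y < n ] ∑[ z < n ] rest x y z
      ≡⟨ sum-cong-≗ (λ y → trans (sum-cong-≗ (χ-∧ (except x Y y) ∘ except y (except x Z)))
                                 (∑-*ˡ (χ (except x Y y)) (χ ∘ except y (except x Z)))) ⟩
    ∑[ y < n ] (χ (except x Y y) * count (except y (except x Z)))
      ≡⟨ ∑-χ*-const (except x Y) (λ y y∈Y∖x → count-except (except x Z) (except-⊆ y y∈Y∖x)) ⟩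
    count (except x Y) * (count (except x Z) ∸ 1)
      ≡⟨ cong₂ (λ a b → a * (b ∸ 1)) (count-except Y (X⊆Y x Xx)) (count-except Z (Y⊆Z x (X⊆Y x Xx))) ⟩
    (count Y ∸ 1) * (count Z ∸ 1 ∸ 1)
      ≡⟨ cong ((count Y ∸ 1) *_) (∸-+-assoc (count Z) 1 1) ⟩
    (count Y ∸ 1) * (count Z ∸ 2) ∎
    where
    except-⊆ : except x Y ⊆ except x Z
    except-⊆ y y∈Y∖x = let Yy , x≠y = ∧-true y∈Y∖x in cong₂ _∧_ (Y⊆Z y Yy) x≠y

-- Arithmetic

*-shift-cancel : ∀ a t d → a * (t + d) ≡ (a + t) * d → t ≡ 0 ⊎ a ≡ d
*-shift-cancel a zero    d _  = inj₁ refl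
*-shift-cancel a (suc t) d eq = inj₂ (*-cancelˡ-≡ a d (suc t) (+-cancelʳ-≡ (a * d) _ _ (begin
  suc t * a + a * d      ≡⟨ solve 3 (λ a t d → (con 1 :+ t) :* a :+ a :* d := a :* ((con 1 :+ t) :+ d)) refl a t d ⟩
  a * (suc t + d)        ≡⟨ eq ⟩
  (a + suc t) * d        ≡⟨ solve 3 (λ a t d → (a :+ (con 1 :+ t)) :* d := (con 1 :+ t) :* d :+ a :* d) refl a t d ⟩
  suc t * d + a * d      ∎)))
  where open +-*-Solver

same-sum-and-product : ∀ {a b c d} → a + b ≡ c + d → a * b ≡ c * d → a ≡ c ⊎ a ≡ d
same-sum-and-product {a} {b} {c} {d} sum≡ prod≡ with ≤-total a c
... | inj₁ a≤c with t , refl ← m≤n⇒∃[o]m+o≡n a≤c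
               with refl ← +-cancelˡ-≡ a b (t + d) (trans sum≡ (+-assoc a t d))
               with *-shift-cancel a t d prod≡
...   | inj₁ refl = inj₁ (sym (+-identityʳ a))
...   | inj₂ a≡d  = inj₂ a≡d
same-sum-and-product {a} {b} {c} {d} sum≡ prod≡
    | inj₂ c≤a with t , refl ← m≤n⇒∃[o]m+o≡n c≤a
               with refl ← +-cancelˡ-≡ c d (t + b) (trans (sym sum≡) (+-assoc c t b))
               with *-shift-cancel c t b (sym prod≡)
...   | inj₁ refl = inj₁ (+-identityʳ c)
...   | inj₂ c≡b  = inj₂ (trans (+-comm c t) (cong (t +_) c≡b))

sum-from-products : ∀ {a b c d} → suc a * suc b ≡ suc c * suc d → a * b ≡ c * d → a + b ≡ c + d
sum-from-products {a} {b} {c} {d} shifted≡ prod≡ = suc-injective (+-cancelʳ-≡ (a * b) _ _ (begin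
  suc (a + b) + a * b       ≡⟨ solve 2 (λ a b → con 1 :+ (a :+ b) :+ a :* b := (con 1 :+ a) :* (con 1 :+ b)) refl a b ⟩
  suc a * suc b             ≡⟨ shifted≡ ⟩
  suc c * suc d             ≡⟨ solve 2 (λ c d → (con 1 :+ c) :* (con 1 :+ d) := con 1 :+ (c :+ d) :+ c :* d) refl c d ⟩
  suc (c + d) + c * d       ≡⟨ cong (suc (c + d) +_) prod≡ ⟨
  suc (c + d) + a * b       ∎))
  where open +-*-Solver

module _ {V k o c b : ℕ}
         (all-eq   : (3 + V) * (2 + V) * (1 + V) ≡ b * (k * (k ∸ 1) * (k ∸ 2)))
         (orbit-eq : o * (2 + V) * (1 + V) ≡ b * (c * (k ∸ 1) * (k ∸ 2))) where
  open +-*-Solver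

  orbit-ratio : o * k ≡ c * (3 + V)
  orbit-ratio = *-cancelʳ-≡ _ _ ((2 + V) * (1 + V)) (begin
    o * k * ((2 + V) * (1 + V))                ≡⟨ solve 4 (λ o k v₁ v₂ → o :* k :* (v₁ :* v₂) := k :* (o :* v₁ :* v₂)) refl o k (2 + V) (1 + V) ⟩
    k * (o * (2 + V) * (1 + V))                ≡⟨ cong (k *_) orbit-eq ⟩
    k * (b * (c * (k ∸ 1) * (k ∸ 2)))          ≡⟨ solve 5 (λ k k₁ k₂ b c → k :* (b :* (c :* k₁ :* k₂)) := c :* (b :* (k :* k₁ :* k₂))) refl k (k ∸ 1) (k ∸ 2) b c ⟩
    c * (b * (k * (k ∸ 1) * (k ∸ 2)))          ≡⟨ cong (c *_) all-eq ⟨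
    c * ((3 + V) * (2 + V) * (1 + V))          ≡⟨ solve 4 (λ c v v₁ v₂ → c :* (v :* v₁ :* v₂) := c :* v :* (v₁ :* v₂)) refl c (3 + V) (2 + V) (1 + V) ⟩
    c * (3 + V) * ((2 + V) * (1 + V))          ∎)

  shifted-orbit-ratio : ∀ {o′} → o ≡ suc o′ → o * (o ∸ 1) * (1 + V) ≡ b * (c * (c ∸ 1) * (k ∸ 2)) →
                        o′ * (k ∸ 1) ≡ (c ∸ 1) * (2 + V)
  shifted-orbit-ratio {o′} refl orbit²-eq = *-cancelˡ-≡ _ _ (suc o′ * (1 + V)) (begin
    suc o′ * (1 + V) * (o′ * (k ∸ 1))                ≡⟨ solve 4 (λ o o₁ k₁ v₂ → o :* v₂ :* (o₁ :* k₁) := k₁ :* (o :* o₁ :* v₂)) refl (suc o′) o′ (k ∸ 1) (1 + V) ⟩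
    (k ∸ 1) * (suc o′ * o′ * (1 + V))                ≡⟨ cong ((k ∸ 1) *_) orbit²-eq ⟩
    (k ∸ 1) * (b * (c * (c ∸ 1) * (k ∸ 2)))          ≡⟨ solve 5 (λ k₁ k₂ b c c₁ → k₁ :* (b :* (c :* c₁ :* k₂)) := c₁ :* (b :* (c :* k₁ :* k₂))) refl (k ∸ 1) (k ∸ 2) b c (c ∸ 1) ⟩
    (c ∸ 1) * (b * (c * (k ∸ 1) * (k ∸ 2)))          ≡⟨ cong ((c ∸ 1) *_) orbit-eq ⟨
    (c ∸ 1) * (suc o′ * (2 + V) * (1 + V))           ≡⟨ solve 4 (λ c₁ o v₁ v₂ → c₁ :* (o :* v₁ :* v₂) := o :* v₂ :* (c₁ :* v₁)) refl (c ∸ 1) (suc o′) (2 + V) (1 + V) ⟩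
    suc o′ * (1 + V) * ((c ∸ 1) * (2 + V))           ∎)

-- The equations for a point orbit O (o = |O|, c = |O ∩ B|) give o k = c v and
-- (o - 1)(k - 1) = (c - 1)(v - 1) after dividing by the first one, so the pairs
-- {o - 1, k - 1} and {c - 1, v - 1} have equal sums and products.
orbit-equations⇒ : ∀ {V k o c b} → 1 ≤ o →
  (3 + V) * (2 + V) * (1 + V) ≡ b * (k * (k ∸ 1) * (k ∸ 2)) →
  o * (2 + V) * (1 + V) ≡ b * (c * (k ∸ 1) * (k ∸ 2)) →
  o * (o ∸ 1) * (1 + V) ≡ b * (c * (c ∸ 1) * (k ∸ 2)) →
  o ≡ 3 + V ⊎ k ≡ 3 + V
orbit-equations⇒ {k = zero} {b = b} _ all-eq _ _ = contradiction (trans all-eq (*-zeroʳ b)) λ ()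
orbit-equations⇒ {V} {suc k′} {suc o′} {zero} {b} _ all-eq orbit-eq _ =
  contradiction (orbit-ratio {V} {suc k′} {suc o′} {zero} {b} all-eq orbit-eq) λ ()
orbit-equations⇒ {V} {suc k′} {suc o′} {suc c′} {b} _ all-eq orbit-eq orbit²-eq =
  [ inj₂ ∘ k≡v , inj₁ ∘ cong suc ]′ (same-sum-and-product {o′} {k′} {c′} {2 + V} sum≡ shifted-ratio)
  where
  shifted-ratio : o′ * k′ ≡ c′ * (2 + V)
  shifted-ratio = shifted-orbit-ratio {V} {suc k′} {suc o′} {suc c′} {b} all-eq orbit-eq refl orbit²-eq
  sum≡ : o′ + k′ ≡ c′ + (2 + V)
  sum≡ = sum-from-products {o′} {k′} {c′} {2 + V} (orbit-ratio {V} {suc k′} {suc o′} {suc c′} {b} all-eq orbit-eq) shifted-ratio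
  k≡v : o′ ≡ c′ → suc k′ ≡ 3 + V
  k≡v refl = cong suc (+-cancelˡ-≡ o′ k′ (2 + V) sum≡)

∣-by-double-count : ∀ {v P b K X Y} .{{_ : NonZero v}} → v * P ≡ b * K → v * X ≡ b * Y → P ∣ K * X
∣-by-double-count {v} {P} {b} {K} {X} {Y} vP≡bK vX≡bY = divides Y (*-cancelˡ-≡ _ _ v (begin
  v * (K * X)     ≡⟨ solve 3 (λ v K X → v :* (K :* X) := K :* (v :* X)) refl v K X ⟩
  K * (v * X)     ≡⟨ cong (K *_) vX≡bY ⟩
  K * (b * Y)     ≡⟨ solve 3 (λ K b Y → K :* (b :* Y) := b :* K :* Y) refl K b Y ⟩
  b * K * Y       ≡⟨ cong (_* Y) vP≡bK ⟨
  v * P * Y       ≡⟨ solve 3 (λ v P Y → v :* P :* Y := v :* (Y :* P)) refl v P Y ⟩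
  v * (Y * P)     ∎))
  where open +-*-Solver

∣-complete-design : ∀ V X → (2 + V) * (1 + V) ∣ (3 + V) * (2 + V) * (1 + V) * X
∣-complete-design V X = divides ((3 + V) * X)
  (solve 2 (λ V X → (con 3 :+ V) :* (con 2 :+ V) :* (con 1 :+ V) :* X := (con 3 :+ V) :* X :* ((con 2 :+ V) :* (con 1 :+ V))) refl V X)
  where open +-*-Solver

-- Lists

length-filter≡count : ∀ {A : Set} {P : A → Set} (P? : ∀ x → Dec (P x)) (xs : List A) →
                      length (filter P? xs) ≡ count (λ j → does (P? (lookup xs j)))
length-filter≡count P? []       = refl
length-filter≡count P? (x ∷ xs) with does (P? x)
... | true  = cong suc (length-filter≡count P? xs)
... | false = length-filter≡count P? xs

any-filter⇔ : ∀ {A : Set} {P Q : A → Set} (P? : ∀ x → Dec (P x)) (xs : List A) →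
              Any Q (filter P? xs) ⇔ ∃ λ j → P (lookup xs j) × Q (lookup xs j)
any-filter⇔ P? [] = mk⇔ (λ ()) λ ()
any-filter⇔ {P = P} {Q} P? (x ∷ xs) with P? x | any-filter⇔ {Q = Q} P? xs
... | yes Px | ih = mk⇔ to from
  where
  to : Any Q (x ∷ filter P? xs) → ∃ λ j → P (lookup (x ∷ xs) j) × Q (lookup (x ∷ xs) j)
  to (here Qx)  = zero , Px , Qx
  to (there q)  = let j , pq = Equivalence.to ih q in suc j , pq
  from : (∃ λ j → P (lookup (x ∷ xs) j) × Q (lookup (x ∷ xs) j)) → Any Q (x ∷ filter P? xs)
  from (zero , _ , Qx) = here Qx
  from (suc j , pq)    = there (Equivalence.from ih (j , pq))
... | no ¬Px | ih = mk⇔ to from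
  where
  to : Any Q (filter P? xs) → ∃ λ j → P (lookup (x ∷ xs) j) × Q (lookup (x ∷ xs) j)
  to q = let j , pq = Equivalence.to ih q in suc j , pq
  from : (∃ λ j → P (lookup (x ∷ xs) j) × Q (lookup (x ∷ xs) j)) → Any Q (filter P? xs)
  from (zero , Px , _) = contradiction Px ¬Px
  from (suc j , pq)    = Equivalence.from ih (j , pq)

allPairs-lookup-injective : ∀ {A : Set} {_≈_ : A → A → Set} → (∀ {x y} → x ≈ y → y ≈ x) →
                            {xs : List A} → AllPairs (λ x y → ¬ x ≈ y) xs →
                            ∀ i j → lookup xs i ≈ lookup xs j → i ≡ j
allPairs-lookup-injective sym≈ (_ ∷ _)      zero    zero    _   = refl
allPairs-lookup-injective sym≈ (x≉xs ∷ _)   zero    (suc j) x≈y = contradiction x≈y (All.lookup x≉xs (∈-lookup j))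
allPairs-lookup-injective sym≈ (x≉xs ∷ _)   (suc i) zero    y≈x = contradiction (sym≈ y≈x) (All.lookup x≉xs (∈-lookup i))
allPairs-lookup-injective sym≈ (_ ∷ pairs)  (suc i) (suc j) eq  = cong suc (allPairs-lookup-injective sym≈ pairs i j eq)

-- Finite permutation groups

module Group {v k} {D : Steiner3Design v k} (G : AutSubgroup D) where

  N : ℕ
  N = length (elems G)

  g : Fin N → Fin v → Fin v
  g = lookup (elems G)

  g-injective : ∀ j → Injective _≡_ _≡_ (g j)
  g-injective j = proj₁ (auts G (∈-lookup j))

  g-ext-injective : ∀ i j → g i ≗ g j → i ≡ j
  g-ext-injective = allPairs-lookup-injective (λ f≗h → sym ∘ f≗h) (distinct G)

  _·_ : Fin N → Fin N → Fin N
  i · j = Any.index (closed G (∈-lookup i) (∈-lookup j))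

  ·-spec : ∀ i j x → g (i · j) x ≡ g i (g j x)
  ·-spec i j = lookup-index (closed G (∈-lookup i) (∈-lookup j))

  ε : Fin N
  ε = Any.index (hasId G)

  ε-spec : ∀ x → g ε x ≡ x
  ε-spec = lookup-index (hasId G)

  ·-injectiveʳ : ∀ j → Injective _≡_ _≡_ (_· j)
  ·-injectiveʳ j {a} {b} a·j≡b·j = g-ext-injective a b λ x → begin
    g a x                 ≡⟨ cong (g a) (proj₂ (g-surjective x)) ⟨
    g a (g j (x′ x))      ≡⟨ ·-spec a j (x′ x) ⟨
    g (a · j) (x′ x)      ≡⟨ cong (λ c → g c (x′ x)) a·j≡b·j ⟩
    g (b · j) (x′ x)      ≡⟨ ·-spec b j (x′ x) ⟩
    g b (g j (x′ x))      ≡⟨ cong (g b) (proj₂ (g-surjective x)) ⟩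
    g b x                 ∎
    where
    g-surjective : ∀ x → ∃ λ y → g j y ≡ x
    g-surjective = injective⇒surjective (g-injective j)
    x′ : Fin v → Fin v
    x′ x = proj₁ (g-surjective x)

  right-divide : ∀ i j → ∃ λ s → ∀ x → g s (g i x) ≡ g j x
  right-divide i j with s , s·i≡j ← injective⇒surjective (·-injectiveʳ i) j =
    s , λ x → trans (sym (·-spec s i x)) (cong (λ c → g c x) s·i≡j)

  module _ {Q : (Fin v → Fin v) → Set} (Q? : ∀ f → Dec (Q f))
           (Q-resp : ∀ {f f′} → f ≗ f′ → Q f → Q f′) where

    any-·-invariant : ∀ i → does (any? λ j → Q? (g j ∘ g i)) ≡ does (any? λ j → Q? (g j))
    any-·-invariant i = does-⇔ (mk⇔ to from) (any? λ j → Q? (g j ∘ g i)) (any? λ j → Q? (g j))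
      where
      to : (∃ λ j → Q (g j ∘ g i)) → ∃ λ j → Q (g j)
      to (j , q) = j · i , Q-resp (sym ∘ ·-spec j i) q
      from : (∃ λ j → Q (g j)) → ∃ λ j → Q (g j ∘ g i)
      from (j , q) with s , s∘i≗j ← right-divide i j = s , Q-resp (sym ∘ s∘i≗j) q

  module OrbitStabilizer {X : Set} (_≟ₓ_ : DecidableEquality X) (act : Fin N → X → X)
                         (act-· : ∀ i j t → act (i · j) t ≡ act i (act j t)) (τ : X) where

    stabilizerSize : ℕ
    stabilizerSize = count λ j → does (act j τ ≟ₓ τ)

    reaches : X → Bool
    reaches t = does (any? λ j → act j t ≟ₓ τ)

    transporters : ∀ t → count (λ j → does (act j t ≟ₓ τ)) ≡ χ (reaches t) * stabilizerSize
    transporters t with any? (λ j → act j t ≟ₓ τ)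
    ... | no unreachable = count-zero _ (λ j → dec-false (act j t ≟ₓ τ) (unreachable ∘ (j ,_)))
    ... | yes (j₀ , j₀t≡τ) = begin
      count (λ j → does (act j t ≟ₓ τ))                ≡⟨ ∑-reindex (·-injectiveʳ j₀) _ ⟨
      ∑[ j < N ] χ (does (act (j · j₀) t ≟ₓ τ))        ≡⟨ sum-cong-≗ (λ j → cong (λ u → χ (does (u ≟ₓ τ))) (trans (act-· j j₀ t) (cong (act j) j₀t≡τ))) ⟩
      stabilizerSize                                  ≡⟨ +-identityʳ _ ⟨
      1 * stabilizerSize                              ∎

  transporters-total : ∀ α → ∑[ y < v ] count (λ j → g j y == α) ≡ N
  transporters-total α = begin
    ∑[ y < v ] ∑[ j < N ] χ (g j y == α)   ≡⟨ ∑-comm (λ y j → χ (g j y == α)) ⟩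
    ∑[ j < N ] ∑[ y < v ] χ (g j y == α)   ≡⟨ sum-cong-≗ (λ j → trans (∑-reindex (g-injective j) (λ y → χ (y == α))) (∑-==-point α)) ⟩
    ∑[ j < N ] 1                               ≡⟨ trans (∑-const N 1) (*-identityʳ N) ⟩
    N                                          ∎

  act₃ : Fin N → Triple v → Triple v
  act₃ j (x , y , z) = g j x , g j y , g j z

  act₃-· : ∀ i j t → act₃ (i · j) t ≡ act₃ i (act₃ j t)
  act₃-· i j (x , y , z) = cong₂ _,_ (·-spec i j x) (cong₂ _,_ (·-spec i j y) (·-spec i j z))

  triple-transporters-total : ∀ τ → ∑₃ (λ x y z → count (λ j → does (act₃ j (x , y , z) ≟₃ τ))) ≡ N
  triple-transporters-total τ = begin
    ∑₃ (λ x y z → ∑[ j < N ] hits j x y z)        ≡⟨ ∑-∑₃-comm hits ⟨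
    ∑[ j < N ] ∑₃ (hits j)                        ≡⟨ sum-cong-≗ (λ j → trans (∑₃-reindex (g-injective j) (λ x y z → χ (does ((x , y , z) ≟₃ τ)))) (∑₃-point τ)) ⟩
    ∑[ j < N ] 1                                  ≡⟨ trans (∑-const N 1) (*-identityʳ N) ⟩
    N                                             ∎
    where
    hits : Fin N → Fin v → Fin v → Fin v → ℕ
    hits j x y z = χ (does (act₃ j (x , y , z) ≟₃ τ))

  suborbit : Fin v → Fin v → Fin v → Bool
  suborbit α β y = does (any? λ j → (g j α ≟ α) ×-dec (g j β ≟ y))

  stabOrder≡count : ∀ α → stabOrder G α ≡ count (λ j → g j α == α)
  stabOrder≡count α = length-filter≡count (λ h → h α ≟ α) (elems G)

  subdegree≡count : ∀ α β → subdegree G α β ≡ count (suborbit α β)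
  subdegree≡count α β = trans (count-tabulate tabulated) (sum-cong-≗ λ γ → cong χ (trans
    (isYes≗does (List.any? (λ h → h β ≟ γ) (stabilizer G α)))
    (does-⇔ (any-filter⇔ (λ h → h α ≟ α) (elems G)) (List.any? (λ h → h β ≟ γ) (stabilizer G α))
            (any? λ j → (g j α ≟ α) ×-dec (g j β ≟ γ)))))
    where
    tabulated : Fin v → Bool
    tabulated γ = ⌊ List.any? (λ h → h β ≟ γ) (stabilizer G α) ⌋

-- Block-transitive Steiner 3-designs

lookup-mapsTo : ∀ {v} {h : Fin v → Fin v} {B B′ : Subset v} → MapsTo h B B′ →
                ∀ x → Vec.lookup B′ (h x) ≡ Vec.lookup B x
lookup-mapsTo {h = h} {B} {B′} h[B]≡B′ x = ≡true-ext
  (λ hx∈B′ → Vec.[]=⇒lookup (Equivalence.from (h[B]≡B′ x) (Vec.lookup⇒[]= (h x) B′ hx∈B′)))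
  (λ x∈B → Vec.[]=⇒lookup (Equivalence.to (h[B]≡B′ x) (Vec.lookup⇒[]= x B x∈B)))

module BlockCount {v k} (D : Steiner3Design v k) (G : AutSubgroup D) (transitive : BlockTransitive G) where

  open Group G

  b : ℕ
  b = length (blocks D)

  block : Fin b → Subset v
  block = lookup (blocks D)

  B₀ : Subset v
  B₀ = proj₁ (blocksNonEmpty D)

  inside : Subset v → TripleSet v
  inside B x y z = Vec.lookup B x ∧ Vec.lookup B y ∧ Vec.lookup B z

  _within_ : TripleSet v → Subset v → TripleSet v
  (T within B) x y z = T x y z ∧ inside B x y z

  Invariant : TripleSet v → Set
  Invariant T = ∀ j x y z → T (g j x) (g j y) (g j z) ≡ T x y z

  #₃-within-block : ∀ {T} → Invariant T → ∀ i → #₃ (T within block i) ≡ #₃ (T within B₀)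
  #₃-within-block {T} T-inv i = begin
    #₃ (T within block i)                                   ≡⟨ ∑₃-reindex (g-injective j) counted ⟨
    ∑₃ (λ x y z → counted (g j x) (g j y) (g j z))          ≡⟨ ∑₃-cong (λ x y z → cong χ (pull-back x y z)) ⟩
    #₃ (T within B₀)                                        ∎
    where
    B₀↦Bᵢ : Any (λ h → MapsTo h B₀ (block i)) (elems G)
    B₀↦Bᵢ = transitive (proj₂ (blocksNonEmpty D)) (∈-lookup i)
    j : Fin N
    j = Any.index B₀↦Bᵢ
    counted : Fin v → Fin v → Fin v → ℕ
    counted x y z = χ (distinct₃ x y z ∧ (T within block i) x y z)
    lookup-g : ∀ x → Vec.lookup (block i) (g j x) ≡ Vec.lookup B₀ x
    lookup-g = lookup-mapsTo (lookup-index B₀↦Bᵢ)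
    pull-back : ∀ x y z → distinct₃ (g j x) (g j y) (g j z) ∧ (T within block i) (g j x) (g j y) (g j z)
                          ≡ distinct₃ x y z ∧ (T within B₀) x y z
    pull-back x y z = cong₂ _∧_ (distinct₃-injective (g-injective j) x y z)
                        (cong₂ _∧_ (T-inv j x y z) (cong₂ _∧_ (lookup-g x) (cong₂ _∧_ (lookup-g y) (lookup-g z))))

  inside⇒∈ : ∀ {B x y z} → inside B x y z ≡ true → x ∈ B × y ∈ B × z ∈ B
  inside⇒∈ {B} {x} {y} {z} xyz-inside =
    let x-in , yz-in = ∧-true xyz-inside ; y-in , z-in = ∧-true yz-in
    in Vec.lookup⇒[]= x B x-in , Vec.lookup⇒[]= y B y-in , Vec.lookup⇒[]= z B z-in

  blocks-through : ∀ x y z → distinct₃ x y z ≡ true → count (λ i → inside (block i) x y z) ≡ 1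
  blocks-through x y z xyz-distinct
    with x≠y , yz-distinct ← ∧-true xyz-distinct
    with y≠z , x≠z ← ∧-true yz-distinct
    with B , B∈ , x∈B , y∈B , z∈B ← steinerExists D x y z (not==⇒≢ x≠y) (not==⇒≢ y≠z) (not==⇒≢ x≠z) =
    count-unique _ {Any.index B∈} xyz-in-block unique
    where
    B≡block : B ≡ block (Any.index B∈)
    B≡block = lookup-index B∈
    xyz-in-block : inside (block (Any.index B∈)) x y z ≡ true
    xyz-in-block = subst (λ B′ → inside B′ x y z ≡ true) B≡block
                  (cong₂ _∧_ (Vec.[]=⇒lookup x∈B) (cong₂ _∧_ (Vec.[]=⇒lookup y∈B) (Vec.[]=⇒lookup z∈B)))
    unique : ∀ i → inside (block i) x y z ≡ true → i ≡ Any.index B∈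
    unique i xyz-inside with x∈Bᵢ , y∈Bᵢ , z∈Bᵢ ← inside⇒∈ xyz-inside =
      allPairs-lookup-injective sym (blocksUnique D) i (Any.index B∈) (trans
        (steinerUnique D x y z (not==⇒≢ x≠y) (not==⇒≢ y≠z) (not==⇒≢ x≠z) (block i) B
           (∈-lookup i) x∈Bᵢ y∈Bᵢ z∈Bᵢ B∈ x∈B y∈B z∈B)
        B≡block)

  ∑-#₃-within-blocks : ∀ (T : TripleSet v) → ∑[ i < b ] #₃ (T within block i) ≡ #₃ T
  ∑-#₃-within-blocks T = begin
    ∑[ i < b ] #₃ (T within block i)                             ≡⟨ ∑-∑₃-comm counted ⟩
    ∑₃ (λ x y z → ∑[ i < b ] counted i x y z)                    ≡⟨ ∑₃-cong in-one-block ⟩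
    #₃ T                                                         ∎
    where
    counted : Fin b → Fin v → Fin v → Fin v → ℕ
    counted i x y z = χ (distinct₃ x y z ∧ (T within block i) x y z)
    in-one-block : ∀ x y z → ∑[ i < b ] counted i x y z ≡ χ (distinct₃ x y z ∧ T x y z)
    in-one-block x y z = begin
      ∑[ i < b ] counted i x y z
        ≡⟨ sum-cong-≗ (λ i → trans (cong χ (sym (∧-assoc (distinct₃ x y z) (T x y z) (inside (block i) x y z))))
                                   (χ-∧ (distinct₃ x y z ∧ T x y z) (inside (block i) x y z))) ⟩
      ∑[ i < b ] (χ (distinct₃ x y z ∧ T x y z) * χ (inside (block i) x y z))
        ≡⟨ ∑-*ˡ (χ (distinct₃ x y z ∧ T x y z)) (λ i → χ (inside (block i) x y z)) ⟩
      χ (distinct₃ x y z ∧ T x y z) * count (λ i → inside (block i) x y z)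
        ≡⟨ χ*-cong (distinct₃ x y z ∧ T x y z) (blocks-through x y z ∘ proj₁ ∘ ∧-true) ⟩
      χ (distinct₃ x y z ∧ T x y z) * 1
        ≡⟨ *-identityʳ _ ⟩
      χ (distinct₃ x y z ∧ T x y z) ∎

  #₃-invariant : ∀ {T} → Invariant T → #₃ T ≡ b * #₃ (T within B₀)
  #₃-invariant {T} T-inv = begin
    #₃ T                                ≡⟨ ∑-#₃-within-blocks T ⟨
    ∑[ i < b ] #₃ (T within block i)    ≡⟨ sum-cong-≗ (#₃-within-block T-inv) ⟩
    ∑[ i < b ] #₃ (T within B₀)         ≡⟨ ∑-const b _ ⟩
    b * #₃ (T within B₀)                ∎

  _∩_ : (Fin v → Bool) → Subset v → Fin v → Bool
  (X ∩ B) x = X x ∧ Vec.lookup B x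

  PointInvariant : (Fin v → Bool) → Set
  PointInvariant X = ∀ j x → X (g j x) ≡ X x

  ∩-mono : ∀ {X Y} B → X ⊆ Y → (X ∩ B) ⊆ (Y ∩ B)
  ∩-mono B X⊆Y x x∈X∩B = let Xx , x∈B = ∧-true x∈X∩B in cong₂ _∧_ (X⊆Y x Xx) x∈B

  box-within : ∀ X Y Z B x y z → (box X Y Z within B) x y z ≡ box (X ∩ B) (Y ∩ B) (Z ∩ B) x y z
  box-within X Y Z B x y z =
    solve 6 (λ p q r a c e → (p :* (q :* r)) :* (a :* (c :* e)) := (p :* a) :* ((q :* c) :* (r :* e)))
      refl (X x) (Y y) (Z z) (Vec.lookup B x) (Vec.lookup B y) (Vec.lookup B z)
    where open ∨-∧-Solver

  nested-count-equation : ∀ {X Y Z} → PointInvariant X → PointInvariant Y → PointInvariant Z → X ⊆ Y → Y ⊆ Z →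
    count X * (count Y ∸ 1) * (count Z ∸ 2) ≡ b * (count (X ∩ B₀) * (count (Y ∩ B₀) ∸ 1) * (count (Z ∩ B₀) ∸ 2))
  nested-count-equation {X} {Y} {Z} X-inv Y-inv Z-inv X⊆Y Y⊆Z = begin
    count X * (count Y ∸ 1) * (count Z ∸ 2)     ≡⟨ #₃-box X Y Z X⊆Y Y⊆Z ⟨
    #₃ (box X Y Z)                              ≡⟨ #₃-invariant box-inv ⟩
    b * #₃ (box X Y Z within B₀)                ≡⟨ cong (b *_) (∑₃-cong (λ x y z → cong (χ ∘ (distinct₃ x y z ∧_)) (box-within X Y Z B₀ x y z))) ⟩
    b * #₃ (box (X ∩ B₀) (Y ∩ B₀) (Z ∩ B₀))     ≡⟨ cong (b *_) (#₃-box _ _ _ (∩-mono B₀ X⊆Y) (∩-mono B₀ Y⊆Z)) ⟩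
    b * (count (X ∩ B₀) * (count (Y ∩ B₀) ∸ 1) * (count (Z ∩ B₀) ∸ 2)) ∎
    where
    box-inv : Invariant (box X Y Z)
    box-inv j x y z = cong₂ _∧_ (X-inv j x) (cong₂ _∧_ (Y-inv j y) (Z-inv j z))

-- Points are Fin (3 + V), so that v ∸ 1 and v ∸ 2 compute to 2 + V and 1 + V.
module Main {V k} (D : Steiner3Design (3 + V) k) (G : AutSubgroup D) (block-transitive : BlockTransitive G) where

  open Group G
  open BlockCount D G block-transitive

  everything : Fin (3 + V) → Bool
  everything _ = true

  count-everything : count everything ≡ 3 + V
  count-everything = trans (∑-const (3 + V) 1) (*-identityʳ (3 + V))

  count-B₀ : count (everything ∩ B₀) ≡ k
  count-B₀ = trans (sym (∣p∣≡count B₀)) (blockSize D (proj₂ (blocksNonEmpty D)))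

  invariant-everything : PointInvariant everything
  invariant-everything _ _ = refl

  ⊆-everything : ∀ X → X ⊆ everything
  ⊆-everything _ _ _ = refl

  design-equation : (3 + V) * (2 + V) * (1 + V) ≡ b * (k * (k ∸ 1) * (k ∸ 2))
  design-equation = subst₂ (λ n m → n * (n ∸ 1) * (n ∸ 2) ≡ b * (m * (m ∸ 1) * (m ∸ 2))) count-everything count-B₀
    (nested-count-equation invariant-everything invariant-everything invariant-everything (λ _ → id) (λ _ → id))

  module AtPoint (α : Fin (3 + V)) where

    open OrbitStabilizer _≟_ g ·-spec α public
      renaming (reaches to orbit)

    orbit-invariant : PointInvariant orbit
    orbit-invariant j y = any-·-invariant (λ f → f y ≟ α) (λ f≗f′ → trans (sym (f≗f′ y))) j

    orbit-nonempty : 1 ≤ count orbit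
    orbit-nonempty = subst (_≤ count orbit) (cong χ (dec-true (any? _) (ε , ε-spec α))) (term≤∑ (χ ∘ orbit) α)

    c : ℕ
    c = count (orbit ∩ B₀)

    orbit-equation : count orbit * (2 + V) * (1 + V) ≡ b * (c * (k ∸ 1) * (k ∸ 2))
    orbit-equation = subst₂ (λ n m → count orbit * (n ∸ 1) * (n ∸ 2) ≡ b * (c * (m ∸ 1) * (m ∸ 2))) count-everything count-B₀
      (nested-count-equation orbit-invariant invariant-everything invariant-everything (⊆-everything orbit) (λ _ → id))

    orbit²-equation : count orbit * (count orbit ∸ 1) * (1 + V) ≡ b * (c * (c ∸ 1) * (k ∸ 2))
    orbit²-equation = subst₂ (λ n m → count orbit * (count orbit ∸ 1) * (n ∸ 2) ≡ b * (c * (c ∸ 1) * (m ∸ 2))) count-everything count-B₀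
      (nested-count-equation orbit-invariant orbit-invariant invariant-everything (λ _ → id) (⊆-everything orbit))

    transitive-or-complete : (∀ x → ∃ λ j → g j x ≡ α) ⊎ k ≡ 3 + V
    transitive-or-complete =
      Sum.map₁ (λ o≡v x → does⇒ (any? (λ j → g j x ≟ α)) (count≡n⇒all orbit o≡v x))
        (orbit-equations⇒ {V} {k} {count orbit} {c} {b} orbit-nonempty design-equation orbit-equation orbit²-equation)

  module PointTransitive (α : Fin (3 + V)) (reach : ∀ x → ∃ λ j → g j x ≡ α) where

    open AtPoint α

    N≡v*stabilizer : N ≡ (3 + V) * stabilizerSize
    N≡v*stabilizer = begin
      N                                                ≡⟨ transporters-total α ⟨
      ∑[ y < 3 + V ] count (λ j → g j y == α)          ≡⟨ sum-cong-≗ (λ y → trans (transporters y) (cong (λ o → χ o * stabilizerSize) (orbit-full y))) ⟩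
      ∑[ y < 3 + V ] (1 * stabilizerSize)              ≡⟨ ∑-const (3 + V) (1 * stabilizerSize) ⟩
      (3 + V) * (1 * stabilizerSize)                   ≡⟨ cong ((3 + V) *_) (*-identityˡ stabilizerSize) ⟩
      (3 + V) * stabilizerSize                         ∎
      where
      orbit-full : ∀ y → orbit y ≡ true
      orbit-full y = dec-true (any? (λ j → g j y ≟ α)) (reach y)

    y₀ z₀ : Fin (3 + V)
    y₀ = proj₁ (distinct-partners α)
    z₀ = proj₁ (proj₂ (distinct-partners α))

    τ : Triple (3 + V)
    τ = α , y₀ , z₀

    module TripleOrbit = OrbitStabilizer _≟₃_ act₃ act₃-· τ

    τ-orbit : TripleSet (3 + V)
    τ-orbit x y z = TripleOrbit.reaches (x , y , z)

    τ-orbit-invariant : Invariant τ-orbit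
    τ-orbit-invariant j x y z = any-·-invariant (λ f → (f x , f y , f z) ≟₃ τ)
      (λ f≗f′ → trans (cong₂ _,_ (sym (f≗f′ x)) (cong₂ _,_ (sym (f≗f′ y)) (sym (f≗f′ z))))) j

    τ-orbit⇒distinct : ∀ x y z → τ-orbit x y z ≡ true → distinct₃ x y z ≡ true
    τ-orbit⇒distinct x y z xyz∈τG with j , gxyz≡τ ← does⇒ (any? (λ j → act₃ j (x , y , z) ≟₃ τ)) xyz∈τG = begin
      distinct₃ x y z                      ≡⟨ distinct₃-injective (g-injective j) x y z ⟨
      distinct₃ (g j x) (g j y) (g j z)    ≡⟨ cong (λ (a , b , c) → distinct₃ a b c) gxyz≡τ ⟩
      distinct₃ α y₀ z₀                    ≡⟨ proj₂ (proj₂ (distinct-partners α)) ⟩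
      true                                 ∎

    N≡#₃τ-orbit*stabilizer : N ≡ #₃ τ-orbit * TripleOrbit.stabilizerSize
    N≡#₃τ-orbit*stabilizer = begin
      N                                                          ≡⟨ triple-transporters-total τ ⟨
      ∑₃ (λ x y z → count (λ j → does (act₃ j (x , y , z) ≟₃ τ))) ≡⟨ ∑₃-cong (λ x y z → trans (TripleOrbit.transporters (x , y , z))
                                                                      (cong (_* TripleOrbit.stabilizerSize) (cong χ (sym (∧-absorbˡ (τ-orbit⇒distinct x y z)))))) ⟩
      ∑₃ (λ x y z → χ (distinct₃ x y z ∧ τ-orbit x y z) * TripleOrbit.stabilizerSize) ≡⟨ ∑₃-*ʳ TripleOrbit.stabilizerSize (λ x y z → χ (distinct₃ x y z ∧ τ-orbit x y z)) ⟩
      #₃ τ-orbit * TripleOrbit.stabilizerSize                    ∎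

    divides-stabilizerSize : (2 + V) * (1 + V) ∣ k * (k ∸ 1) * (k ∸ 2) * stabilizerSize
    divides-stabilizerSize = ∣-by-double-count {3 + V} {b = b} {X = stabilizerSize} {Y = #₃ (τ-orbit within B₀) * TripleOrbit.stabilizerSize}
      (trans (sym (*-assoc (3 + V) (2 + V) (1 + V))) design-equation) (begin
      (3 + V) * stabilizerSize                                        ≡⟨ N≡v*stabilizer ⟨
      N                                                               ≡⟨ N≡#₃τ-orbit*stabilizer ⟩
      #₃ τ-orbit * TripleOrbit.stabilizerSize                         ≡⟨ cong (_* TripleOrbit.stabilizerSize) (#₃-invariant τ-orbit-invariant) ⟩
      b * #₃ (τ-orbit within B₀) * TripleOrbit.stabilizerSize         ≡⟨ *-assoc b _ _ ⟩
      b * (#₃ (τ-orbit within B₀) * TripleOrbit.stabilizerSize)       ∎)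

    module Suborbit (β : Fin (3 + V)) (β≢α : β ≢ α) where

      Δ : Fin (3 + V) → Bool
      Δ = suborbit α β

      d : ℕ
      d = count Δ

      Δ⇒≢α : ∀ y → Δ y ≡ true → not (α == y) ≡ true
      Δ⇒≢α y y∈Δ with α ≟ y
      ... | no _     = refl
      ... | yes refl with j , gjα≡α , gjβ≡α ← does⇒ (any? (λ j → (g j α ≟ α) ×-dec (g j β ≟ α))) y∈Δ =
        contradiction (g-injective j (trans gjβ≡α (sym gjα≡α))) β≢α

      Δ-closed : ∀ {s w} → g s α ≡ α → Δ w ≡ true → Δ (g s w) ≡ true
      Δ-closed {s} {w} gsα≡α w∈Δ with j , gjα≡α , gjβ≡w ← does⇒ (any? (λ j → (g j α ≟ α) ×-dec (g j β ≟ w))) w∈Δ =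
        dec-true (any? (λ j → (g j α ≟ α) ×-dec (g j β ≟ g s w)))
          (s · j , trans (·-spec s j α) (trans (cong (g s) gjα≡α) gsα≡α) , trans (·-spec s j β) (cong (g s) gjβ≡w))

      Δ-triples : TripleSet (3 + V)
      Δ-triples x y z = does (any? λ j → (g j x ≟ α) ×-dec (Δ (g j y) ≟ᵇ true) ×-dec (Δ (g j z) ≟ᵇ true))

      Δ-triples-invariant : Invariant Δ-triples
      Δ-triples-invariant j x y z = any-·-invariant (λ f → (f x ≟ α) ×-dec (Δ (f y) ≟ᵇ true) ×-dec (Δ (f z) ≟ᵇ true))
        (λ f≗f′ (fx≡α , fy∈Δ , fz∈Δ) → trans (sym (f≗f′ x)) fx≡α ,
                                        subst (λ u → Δ u ≡ true) (f≗f′ y) fy∈Δ ,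
                                        subst (λ u → Δ u ≡ true) (f≗f′ z) fz∈Δ) j

      Δ-triples-at : ∀ {j₀ x} → g j₀ x ≡ α → ∀ y z → Δ-triples x y z ≡ Δ (g j₀ y) ∧ Δ (g j₀ z)
      Δ-triples-at {j₀} {x} gx≡α y z = ≡true-ext to from
        where
        to : Δ-triples x y z ≡ true → Δ (g j₀ y) ∧ Δ (g j₀ z) ≡ true
        to xyz∈ with j , gjx≡α , gjy∈Δ , gjz∈Δ ← does⇒ (any? (λ j → (g j x ≟ α) ×-dec (Δ (g j y) ≟ᵇ true) ×-dec (Δ (g j z) ≟ᵇ true))) xyz∈
                with s , s∘j≗j₀ ← right-divide j j₀ =
          cong₂ _∧_ (subst (λ u → Δ u ≡ true) (s∘j≗j₀ y) (Δ-closed gsα≡α gjy∈Δ))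
                    (subst (λ u → Δ u ≡ true) (s∘j≗j₀ z) (Δ-closed gsα≡α gjz∈Δ))
          where
          gsα≡α : g s α ≡ α
          gsα≡α = trans (cong (g s) (sym gjx≡α)) (trans (s∘j≗j₀ x) gx≡α)
        from : Δ (g j₀ y) ∧ Δ (g j₀ z) ≡ true → Δ-triples x y z ≡ true
        from yz∈Δ = let y∈Δ , z∈Δ = ∧-true yz∈Δ in
          dec-true (any? (λ j → (g j x ≟ α) ×-dec (Δ (g j y) ≟ᵇ true) ×-dec (Δ (g j z) ≟ᵇ true))) (j₀ , gx≡α , y∈Δ , z∈Δ)

      -- An element moving x to α turns the triples over x into ordered pairs of distinct points of Δ.
      pairs-at : ∀ x → ∑[ y < 3 + V ] ∑[ z < 3 + V ] χ (distinct₃ x y z ∧ Δ-triples x y z) ≡ d * (d ∸ 1)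
      pairs-at x with j₀ , gx≡α ← reach x = begin
        ∑[ y < 3 + V ] ∑[ z < 3 + V ] χ (distinct₃ x y z ∧ Δ-triples x y z)
          ≡⟨ sum-cong-≗ (λ y → sum-cong-≗ (λ z → cong χ (cong₂ _∧_ (moved y z) (Δ-triples-at gx≡α y z)))) ⟩
        ∑[ y < 3 + V ] ∑[ z < 3 + V ] F (g j₀ y) (g j₀ z)
          ≡⟨ sum-cong-≗ (λ y → ∑-reindex (g-injective j₀) (F (g j₀ y))) ⟩
        ∑[ y < 3 + V ] ∑[ z < 3 + V ] F (g j₀ y) z
          ≡⟨ ∑-reindex (g-injective j₀) (λ y → ∑[ z < 3 + V ] F y z) ⟩
        ∑[ y < 3 + V ] ∑[ z < 3 + V ] F y z
          ≡⟨ sum-cong-≗ (λ y → sum-cong-≗ (λ z → cong χ (Δ-pair y z))) ⟩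
        ∑[ y < 3 + V ] ∑[ z < 3 + V ] χ (Δ y ∧ except y Δ z)
          ≡⟨ count-pairs Δ ⟩
        d * (d ∸ 1) ∎
        where
        F : Fin (3 + V) → Fin (3 + V) → ℕ
        F y z = χ (distinct₃ α y z ∧ (Δ y ∧ Δ z))
        moved : ∀ y z → distinct₃ x y z ≡ distinct₃ α (g j₀ y) (g j₀ z)
        moved y z = trans (sym (distinct₃-injective (g-injective j₀) x y z)) (cong (λ a → distinct₃ a (g j₀ y) (g j₀ z)) gx≡α)
        Δ-pair : ∀ y z → distinct₃ α y z ∧ (Δ y ∧ Δ z) ≡ Δ y ∧ except y Δ z
        Δ-pair y z = begin
          distinct₃ α y z ∧ (Δ y ∧ Δ z)
            ≡⟨ solve 5 (λ a b c p q → (a :* (b :* c)) :* (p :* q) := (a :* p) :* ((c :* q) :* b))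
                 refl (not (α == y)) (not (y == z)) (not (α == z)) (Δ y) (Δ z) ⟩
          (not (α == y) ∧ Δ y) ∧ ((not (α == z) ∧ Δ z) ∧ not (y == z))
            ≡⟨ cong₂ _∧_ (∧-absorbˡ (Δ⇒≢α y)) (cong (_∧ not (y == z)) (∧-absorbˡ (Δ⇒≢α z))) ⟩
          Δ y ∧ except y Δ z ∎
          where open ∨-∧-Solver

      divides-suborbit-pairs : (2 + V) * (1 + V) ∣ k * (k ∸ 1) * (k ∸ 2) * (d * (d ∸ 1))
      divides-suborbit-pairs = ∣-by-double-count {3 + V} {b = b} {X = d * (d ∸ 1)} {Y = #₃ (Δ-triples within B₀)}
        (trans (sym (*-assoc (3 + V) (2 + V) (1 + V))) design-equation)
        (trans (sym (trans (sum-cong-≗ pairs-at) (∑-const (3 + V) (d * (d ∸ 1))))) (#₃-invariant Δ-triples-invariant))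

  divides-stabOrder : ∀ α → (2 + V) * (1 + V) ∣ k * (k ∸ 1) * (k ∸ 2) * stabOrder G α
  divides-stabOrder α = [
      (λ reach → subst (λ s → (2 + V) * (1 + V) ∣ k * (k ∸ 1) * (k ∸ 2) * s) (sym (stabOrder≡count α))
                   (PointTransitive.divides-stabilizerSize α reach)) ,
      (λ k≡v → subst (λ k → (2 + V) * (1 + V) ∣ k * (k ∸ 1) * (k ∸ 2) * stabOrder G α) (sym k≡v)
                 (∣-complete-design V (stabOrder G α))) ]′
    (AtPoint.transitive-or-complete α)

  divides-subdegree : ∀ α β → β ≢ α →
                      (2 + V) * (1 + V) ∣ k * (k ∸ 1) * (k ∸ 2) * (subdegree G α β * (subdegree G α β ∸ 1))
  divides-subdegree α β β≢α = [
      (λ reach → subst (λ d → (2 + V) * (1 + V) ∣ k * (k ∸ 1) * (k ∸ 2) * (d * (d ∸ 1))) (sym (subdegree≡count α β))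
                   (PointTransitive.Suborbit.divides-suborbit-pairs α reach β β≢α)) ,
      (λ k≡v → subst (λ k → (2 + V) * (1 + V) ∣ k * (k ∸ 1) * (k ∸ 2) * (subdegree G α β * (subdegree G α β ∸ 1))) (sym k≡v)
                 (∣-complete-design V (subdegree G α β * (subdegree G α β ∸ 1)))) ]′
    (AtPoint.transitive-or-complete α)

k≤v : ∀ {v k} (D : Steiner3Design v k) → k ≤ v
k≤v D = subst (_≤ _) (blockSize D (proj₂ (blocksNonEmpty D))) (∣p∣≤n (proj₁ (blocksNonEmpty D)))

k≤2⇒k[k-1][k-2]≡0 : ∀ {k} → k ≤ 2 → k * (k ∸ 1) * (k ∸ 2) ≡ 0
k≤2⇒k[k-1][k-2]≡0 {0} _ = refl
k≤2⇒k[k-1][k-2]≡0 {1} _ = refl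
k≤2⇒k[k-1][k-2]≡0 {2} _ = refl
k≤2⇒k[k-1][k-2]≡0 {suc (suc (suc _))} (s≤s (s≤s ()))

blocks-too-small : ∀ {v k} {D : Steiner3Design v k} (G : AutSubgroup D) {m} → k ≤ 2 →
  (∀ α → m ∣ k * (k ∸ 1) * (k ∸ 2) * stabOrder G α) ×
  (∀ α β → β ≢ α → m ∣ k * (k ∸ 1) * (k ∸ 2) * subdegree G α β * (subdegree G α β ∸ 1))
blocks-too-small G {m} k≤2 =
  (λ α → subst (λ K → m ∣ K * stabOrder G α) (sym (k≤2⇒k[k-1][k-2]≡0 k≤2)) (m ∣0)) ,
  (λ α β _ → subst (λ K → m ∣ K * subdegree G α β * (subdegree G α β ∸ 1)) (sym (k≤2⇒k[k-1][k-2]≡0 k≤2)) (m ∣0))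

lemma2p8 : ∀ {v k} (D : Steiner3Design v k) (G : AutSubgroup D) → BlockTransitive G →
    (∀ (α : Fin v) → (v ∸ 1) * (v ∸ 2) ∣ k * (k ∸ 1) * (k ∸ 2) * stabOrder G α) ×
    (∀ (α β : Fin v) → β ≢ α →
      (v ∸ 1) * (v ∸ 2) ∣ k * (k ∸ 1) * (k ∸ 2) * subdegree G α β * (subdegree G α β ∸ 1))
lemma2p8 {0}                 D G _ = (λ ()) , (λ ())
lemma2p8 {1}                 D G _ = blocks-too-small G (≤-trans (k≤v D) (s≤s z≤n))
lemma2p8 {2}                 D G _ = blocks-too-small G (k≤v D)
lemma2p8 {suc (suc (suc V))} {k} D G block-transitive =
  divides-stabOrder ,
  λ α β β≢α → subst ((2 + V) * (1 + V) ∣_) (sym (*-assoc (k * (k ∸ 1) * (k ∸ 2)) (subdegree G α β) _))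
                (divides-subdegree α β β≢α)
  where open Main D G block-transitive
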